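{- Let $\lambda\in\mathbb{R}$ and let $n,r\ge 0$ be integers. Then \[ D_rF_{n,\lambda}(x)=\sum_{k=0}^{n}\binom{k+r}{k}k!\,S_{2,\lambda}(n,k)\,x^k, \] where $D_r$ is the linear operator on polynomials given by $D_rq(x)=\frac{1}{r!}\big(\frac{d}{dx}\big)^r\big[x^rq(x)\big]$.
   Context: For $\lambda\in\mathbb{R}$, the generalized falling factorials are $(x)_{0,\lambda}=1$ and $(x)_{n,\lambda}=x(x-\lambda)(x-2\lambda)\cdots(x-(n-1)\lambda)$ for $n\ge 1$; $(x)_n$ denotes the ordinary falling factorial $x(x-1)\cdots(x-n+1)$. The degenerate Stirling numbers of the second kind $S_{2,\lambda}(n,k)$ are defined by $(x)_{n,\lambda}=\sum_{k=0}^{n}S_{2,\lambda}(n,k)(x)_k$. The degenerate exponential is $e_\lambda(t)=\sum_{n\ge 0}(1)_{n,\lambda}\frac{t^n}{n!}$, and the degenerate Fubini polynomials are defined by $\frac{1}{1-x(e_\lambda(t)-1)}=\sum_{n=0}^{\infty}F_{n,\lambda}(x)\frac{t^n}{n!}$; equivalently $F_{n,\lambda}(x)=\sum_{k=0}^{n}k!\,S_{2,\lambda}(n,k)x^k$. -}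

module Defs where

open import Data.Nat using (ℕ; zero; suc; _!)
open import Algebra.Bundles using (CommutativeRing)

-- Polynomials over a commutative ring R, represented by their coefficient
-- sequences: p j is the coefficient of x^j (finitely supported in all uses).
module Poly {c ℓ} (R : CommutativeRing c ℓ) where
  open CommutativeRing R

  Polynomial : Set c
  Polynomial = ℕ → Carrier

  fromℕ : ℕ → Carrier
  fromℕ zero = 0#
  fromℕ (suc n) = 1# + fromℕ n

  sumTo : ℕ → (ℕ → Carrier) → Carrier
  sumTo zero f = f 0
  sumTo (suc n) f = sumTo n f + f (suc n)

  _≋_ : Polynomial → Polynomial → Set ℓ
  p ≋ q = ∀ j → p j ≈ q j

  mono : ℕ → Polynomial
  mono zero zero = 1#
  mono zero (suc j) = 0#
  mono (suc k) zero = 0#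
  mono (suc k) (suc j) = mono k j

  X* : Polynomial → Polynomial
  X* p zero = 0#
  X* p (suc j) = p j

  Xpow* : ℕ → Polynomial → Polynomial
  Xpow* zero p = p
  Xpow* (suc r) p = X* (Xpow* r p)

  deriv : Polynomial → Polynomial
  deriv p j = fromℕ (suc j) * p (suc j)

  derivN : ℕ → Polynomial → Polynomial
  derivN zero p = p
  derivN (suc r) p = deriv (derivN r p)

  genFalling : Carrier → ℕ → Polynomial
  genFalling lam zero = mono 0
  genFalling lam (suc n) j = X* (genFalling lam n) j - (fromℕ n * lam) * genFalling lam n j

  falling : ℕ → Polynomial
  falling = genFalling 1#

  IsDegStirling2 : Carrier → (ℕ → ℕ → Carrier) → Set ℓ
  IsDegStirling2 lam S =
    ∀ n → genFalling lam n ≋ (λ j → sumTo n (λ k → S n k * falling k j))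

  fubini : (ℕ → ℕ → Carrier) → ℕ → Polynomial
  fubini S n j = sumTo n (λ k → (fromℕ (k !) * S n k) * mono k j)

  -- D_r q = (1/r!) (d/dx)^r [x^r q], where invr plays the role of 1/r!
  D : (invr : Carrier) → (r : ℕ) → Polynomial → Polynomial
  D invr r q j = invr * derivN r (Xpow* r q) j

-- D_r acts diagonally on monomials: (d/dx)^r x^(k+r) = (k+1)(k+2)⋯(k+r) x^k = C(k+r,k) r! x^k,
-- so D_r x^k = C(k+r,k) x^k, i.e. D_r multiplies the k-th coefficient of any polynomial by C(k+r,k).
module Submission where

open import Defs
open import Data.Nat using (ℕ; zero; suc; _!) renaming (_+_ to _+ℕ_; _*_ to _*ℕ_)
open import Data.Nat.Properties using (+-suc)
open import Data.Nat.Combinatorics using (_C_)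
open import Algebra.Bundles using (CommutativeRing)
import Relation.Binary.PropositionalEquality as ≡

module _ where
  open import Data.Nat
  open import Data.Nat.Properties
  open import Data.Nat.Combinatorics
  open import Data.Nat.DivMod using (m/n*n≡m)
  open ≡ using (_≡_; sym; trans; cong; module ≡-Reasoning)
  open ≡-Reasoning

  rising : ℕ → ℕ → ℕ
  rising k zero = 1
  rising k (suc r) = suc k * rising (suc k) r

  rising*! : ∀ k r → rising k r * k ! ≡ (k + r) !
  rising*! k zero = trans (+-identityʳ (k !)) (cong _! (sym (+-identityʳ k)))
  rising*! k (suc r) = begin
    suc k * rising (suc k) r * k ! ≡⟨ *-assoc (suc k) (rising (suc k) r) (k !) ⟩
    suc k * (rising (suc k) r * k !) ≡⟨ cong (suc k *_) (*-comm (rising (suc k) r) (k !)) ⟩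
    suc k * (k ! * rising (suc k) r) ≡⟨ sym (*-assoc (suc k) (k !) (rising (suc k) r)) ⟩
    suc k ! * rising (suc k) r ≡⟨ *-comm (suc k !) (rising (suc k) r) ⟩
    rising (suc k) r * suc k ! ≡⟨ rising*! (suc k) r ⟩
    (suc k + r) ! ≡⟨ cong _! (sym (+-suc k r)) ⟩
    (k + suc r) ! ∎

  nCk*k!*[n∸k]!≡n! : ∀ {n k} → k ≤ n → (n C k) * (k ! * (n ∸ k) !) ≡ n !
  nCk*k!*[n∸k]!≡n! {n} {k} k≤n = begin
    (n C k) * (k ! * (n ∸ k) !) ≡⟨ cong (_* (k ! * (n ∸ k) !)) (nCk≡n!/k![n-k]! k≤n) ⟩
    n ! / (k ! * (n ∸ k) !) * (k ! * (n ∸ k) !) ≡⟨ m/n*n≡m (k![n∸k]!∣n! k≤n) ⟩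
    n ! ∎
    where instance _ = k !* (n ∸ k) !≢0

  rising≡C*! : ∀ k r → rising k r ≡ ((k + r) C k) * r !
  rising≡C*! k r = *-cancelʳ-≡ _ _ (k !) {{k !≢0}} (begin
    rising k r * k ! ≡⟨ rising*! k r ⟩
    (k + r) ! ≡⟨ sym (nCk*k!*[n∸k]!≡n! (m≤m+n k r)) ⟩
    ((k + r) C k) * (k ! * (k + r ∸ k) !) ≡⟨ cong (λ m → ((k + r) C k) * (k ! * m !)) (m+n∸m≡n k r) ⟩
    ((k + r) C k) * (k ! * r !) ≡⟨ cong (((k + r) C k) *_) (*-comm (k !) (r !)) ⟩
    ((k + r) C k) * (r ! * k !) ≡⟨ sym (*-assoc ((k + r) C k) (r !) (k !)) ⟩
    ((k + r) C k) * r ! * k ! ∎)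

module _ {c ℓ} (R : CommutativeRing c ℓ) where
  open CommutativeRing R
  open Poly R
  open import Algebra.Properties.Semiring.Mult semiring using (_×_; ×1-homo-*)
  open import Algebra.Properties.CommutativeSemigroup *-commutativeSemigroup using (xy∙z≈xz∙y)
  open import Relation.Binary.Reasoning.Setoid setoid

  fromℕ≡×1# : ∀ n → fromℕ n ≡.≡ n × 1#
  fromℕ≡×1# zero = ≡.refl
  fromℕ≡×1# (suc n) = ≡.cong (1# +_) (fromℕ≡×1# n)

  fromℕ-homo-* : ∀ m n → fromℕ (m *ℕ n) ≈ fromℕ m * fromℕ n
  fromℕ-homo-* m n rewrite fromℕ≡×1# (m *ℕ n) | fromℕ≡×1# m | fromℕ≡×1# n = ×1-homo-* m n

  sumTo-cong : ∀ n {f g : ℕ → Carrier} → (∀ k → f k ≈ g k) → sumTo n f ≈ sumTo n g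
  sumTo-cong zero f≈g = f≈g 0
  sumTo-cong (suc n) f≈g = +-cong (sumTo-cong n f≈g) (f≈g (suc n))

  *-distribˡ-sumTo : ∀ n a (f : ℕ → Carrier) → a * sumTo n f ≈ sumTo n (λ k → a * f k)
  *-distribˡ-sumTo zero a f = refl
  *-distribˡ-sumTo (suc n) a f = trans (distribˡ a _ _) (+-congʳ (*-distribˡ-sumTo n a f))

  mono-diagonal : ∀ (w : ℕ → Carrier) a k j → w j * (a * mono k j) ≈ (w k * a) * mono k j
  mono-diagonal w a zero zero = sym (*-assoc (w 0) a 1#)
  mono-diagonal w a zero (suc j) = trans (trans (*-congˡ (zeroʳ a)) (zeroʳ _)) (sym (zeroʳ _))
  mono-diagonal w a (suc k) zero = trans (trans (*-congˡ (zeroʳ a)) (zeroʳ _)) (sym (zeroʳ _))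
  mono-diagonal w a (suc k) (suc j) = mono-diagonal (λ i → w (suc i)) a k j

  Xpow*-+ : ∀ r q j → Xpow* r q (r +ℕ j) ≡.≡ q j
  Xpow*-+ zero q j = ≡.refl
  Xpow*-+ (suc r) q j = Xpow*-+ r q j

  derivN-coefficient : ∀ r p j → derivN r p j ≈ fromℕ (rising j r) * p (r +ℕ j)
  derivN-coefficient zero p j = sym (trans (*-congʳ (+-identityʳ 1#)) (*-identityˡ (p j)))
  derivN-coefficient (suc r) p j = begin
    fromℕ (suc j) * derivN r p (suc j)
      ≈⟨ *-congˡ (derivN-coefficient r p (suc j)) ⟩
    fromℕ (suc j) * (fromℕ (rising (suc j) r) * p (r +ℕ suc j))
      ≈⟨ sym (*-assoc _ _ _) ⟩
    fromℕ (suc j) * fromℕ (rising (suc j) r) * p (r +ℕ suc j)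
      ≈⟨ *-cong (sym (fromℕ-homo-* (suc j) (rising (suc j) r))) (reflexive (≡.cong p (+-suc r j))) ⟩
    fromℕ (rising j (suc r)) * p (suc r +ℕ j) ∎

  D-coefficient : ∀ {invr} r → fromℕ (r !) * invr ≈ 1# →
                  ∀ q j → D invr r q j ≈ fromℕ ((j +ℕ r) C j) * q j
  D-coefficient {invr} r r!*invr≈1 q j = begin
    invr * derivN r (Xpow* r q) j
      ≈⟨ *-congˡ (trans (derivN-coefficient r _ j) (*-congˡ (reflexive (Xpow*-+ r q j)))) ⟩
    invr * (fromℕ (rising j r) * q j)
      ≈⟨ *-congˡ (*-congʳ (trans (reflexive (≡.cong fromℕ (rising≡C*! j r))) (fromℕ-homo-* ((j +ℕ r) C j) (r !)))) ⟩
    invr * ((b * fromℕ (r !)) * q j)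
      ≈⟨ *-comm invr _ ⟩
    (b * fromℕ (r !)) * q j * invr
      ≈⟨ *-congʳ (xy∙z≈xz∙y b (fromℕ (r !)) (q j)) ⟩
    (b * q j) * fromℕ (r !) * invr
      ≈⟨ *-assoc (b * q j) _ invr ⟩
    (b * q j) * (fromℕ (r !) * invr)
      ≈⟨ trans (*-congˡ r!*invr≈1) (*-identityʳ _) ⟩
    b * q j ∎
    where b = fromℕ ((j +ℕ r) C j)

theorem10 : ∀ {c ℓ} (R : CommutativeRing c ℓ) →
    let open CommutativeRing R
        open Poly R
    in (lam : Carrier) (S : ℕ → ℕ → Carrier) → IsDegStirling2 lam S →
       (n r : ℕ) (invr : Carrier) → fromℕ (r !) * invr ≈ 1# →
       D invr r (fubini S n) ≋
         (λ j → sumTo n (λ k → (fromℕ ((k +ℕ r) C k) * (fromℕ (k !) * S n k)) * mono k j))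
theorem10 R _ S _ n r invr r!*invr≈1 j = begin
  D invr r (fubini S n) j
    ≈⟨ D-coefficient R r r!*invr≈1 (fubini S n) j ⟩
  binom j * sumTo n (λ k → a k * mono k j)
    ≈⟨ *-distribˡ-sumTo R n (binom j) _ ⟩
  sumTo n (λ k → binom j * (a k * mono k j))
    ≈⟨ sumTo-cong R n (λ k → mono-diagonal R binom (a k) k j) ⟩
  sumTo n (λ k → (binom k * a k) * mono k j) ∎
  where
    open CommutativeRing R
    open Poly R
    open import Relation.Binary.Reasoning.Setoid setoid
    binom a : ℕ → Carrier
    binom k = fromℕ ((k +ℕ r) C k)
    a k = fromℕ (k !) * S n k
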